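{- Let $X=\{x_1,\ldots,x_m,y_1,\ldots,y_k\}$ be a set of $m+k$ distinct elements, where $m,k\in\mathbb{N}$ (positive integers). Let $\alpha\in\mathcal{T}(X)$ be defined by $x_i\alpha=x_{i+1}$ for $i<m$, $x_m\alpha=x_1$, $y_j\alpha=y_{j+1}$ for $j<k$, and $y_k\alpha=x_1$. Let $\beta\in\mathcal{P}(X)\setminus\mathcal{T}(X)$. If $\alpha\beta=\beta\alpha$, then $\beta=\emptyset$.
   Context: $\mathcal{P}(X)$ is the semigroup of all partial transformations of $X$ (functions with domain and image contained in $X$, including the empty map $\emptyset$) under composition, maps acting on the right ($x(\alpha\beta)=(x\alpha)\beta$). $\mathcal{T}(X)$ is the set of full transformations (domain $X$). -}

module Defs where

open import Data.Nat using (ℕ; suc; _<?_)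
open import Data.Fin using (Fin; zero; toℕ; fromℕ<)
open import Data.Sum using (_⊎_; inj₁; inj₂)
open import Data.Maybe using (Maybe; just; nothing; _>>=_)
open import Data.Product using (∃)
open import Relation.Binary.PropositionalEquality using (_≡_)
open import Relation.Nullary using (yes; no)

-- The carrier X = {x_1..x_m} ⊎ {y_1..y_k}, with m = suc m', k = suc k'
-- (both positive). x_i is  inj₁ i' , y_j is  inj₂ j'  with i' = i-1, j' = j-1.
X : ℕ → ℕ → Set
X m' k' = Fin (suc m') ⊎ Fin (suc k')

Partial : Set → Set
Partial A = A → Maybe A

-- Composition with maps acting on the right: x(αβ) = (xα)β.
_⨾_ : {A : Set} → Partial A → Partial A → Partial A
(α ⨾ β) x = α x >>= β

full : {A : Set} → (A → A) → Partial A
full f x = just (f x)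

NotFull : {A : Set} → Partial A → Set
NotFull β = ∃ λ x → β x ≡ nothing

IsEmpty : {A : Set} → Partial A → Set
IsEmpty β = ∀ x → β x ≡ nothing

α : (m' k' : ℕ) → X m' k' → X m' k'
α m' k' (inj₁ i) with suc (toℕ i) <? suc m'
... | yes p = inj₁ (fromℕ< p)
... | no _  = inj₁ zero
α m' k' (inj₂ j) with suc (toℕ j) <? suc k'
... | yes p = inj₂ (fromℕ< p)
... | no _  = inj₁ zero

-- Commuting with α means β(xα) = (xβ)α, so the domain of β is closed under α in both
-- directions: xβ is undefined iff (xα)β is. Every point of X reaches x₁ under iterates
-- of α (the x-cycle and the y-tail both lead there), so if β is undefined at one point
-- it is undefined at x₁, hence at every point.
module Submission where

open import Defs
open import Data.Nat using (ℕ; zero; suc; _<_; _<?_; s<s; s<s⁻¹)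
open import Data.Nat.Properties using (<-irrefl)
open import Data.Nat.GeneralisedArithmetic using (iterate)
open import Data.Fin using (Fin; zero; suc; toℕ; fromℕ; fromℕ<; inject₁)
open import Data.Fin.Properties using (toℕ-injective; toℕ-fromℕ<; toℕ-fromℕ; toℕ-inject₁; inject₁ℕ<)
open import Data.Fin.Induction using (>-weakInduction)
open import Data.Sum using (inj₁; inj₂)
open import Data.Maybe using (just; nothing)
open import Data.Product using (∃; _,_)
open import Function using (_∘_)
open import Relation.Binary.PropositionalEquality using (_≡_; refl; sym; trans; cong; subst)
open import Relation.Nullary using (¬_; yes; no; contradiction)

Reaches : {A : Set} → (A → A) → A → A → Set
Reaches f t x = ∃ λ c → iterate f x c ≡ t

reaches-step : {A : Set} {f : A → A} {t x : A} → Reaches f t (f x) → Reaches f t x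
reaches-step (c , fx↝t) = suc c , fx↝t

chain-reaches : {A : Set} {n : ℕ} (f : A → A) (e : Fin (suc n) → A) (t : A) →
  f (e (fromℕ n)) ≡ t →
  (∀ i → f (e (inject₁ i)) ≡ e (suc i)) →
  ∀ i → Reaches f t (e i)
chain-reaches f e t last next =
  >-weakInduction (Reaches f t ∘ e)
    (reaches-step (0 , last))
    (λ i reach → reaches-step (subst (Reaches f t) (sym (next i)) reach))

module _ {A : Set} (f : A → A) (β : Partial A)
         (commute : ∀ x → (full f ⨾ β) x ≡ (β ⨾ full f) x) where

  undefined-step : ∀ x → β x ≡ nothing → β (f x) ≡ nothing
  undefined-step x βx≡∅ rewrite commute x | βx≡∅ = refl

  undefined-unstep : ∀ x → β (f x) ≡ nothing → β x ≡ nothing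
  undefined-unstep x βfx≡∅ with β x | trans (sym βfx≡∅) (commute x)
  ... | nothing | _ = refl
  ... | just _  | ()

  undefined-iterate : ∀ c x → β x ≡ nothing → β (iterate f x c) ≡ nothing
  undefined-iterate zero    x βx≡∅ = βx≡∅
  undefined-iterate (suc c) x βx≡∅ = undefined-iterate c (f x) (undefined-step x βx≡∅)

  undefined-uniterate : ∀ c x → β (iterate f x c) ≡ nothing → β x ≡ nothing
  undefined-uniterate zero    x βfᶜx≡∅ = βfᶜx≡∅
  undefined-uniterate (suc c) x βfᶜx≡∅ =
    undefined-unstep x (undefined-uniterate c (f x) βfᶜx≡∅)

  commuting-with-funnel-isEmpty : (t : A) → (∀ x → Reaches f t x) →
    NotFull β → IsEmpty β
  commuting-with-funnel-isEmpty t reach (x₀ , βx₀≡∅) x with reach x₀ | reach x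
  ... | c₀ , fᶜ⁰x₀≡t | c , fᶜx≡t =
    undefined-uniterate c x (subst (λ y → β y ≡ nothing) (sym fᶜx≡t)
      (subst (λ y → β y ≡ nothing) fᶜ⁰x₀≡t (undefined-iterate c₀ x₀ βx₀≡∅)))

fromℕ<-inject₁ : {n : ℕ} (i : Fin n) .(p : suc (toℕ (inject₁ i)) < suc n) → fromℕ< p ≡ suc i
fromℕ<-inject₁ i p = toℕ-injective (trans (toℕ-fromℕ< p) (cong suc (toℕ-inject₁ i)))

fromℕ-suc≮ : (n : ℕ) → ¬ suc (toℕ (fromℕ n)) < suc n
fromℕ-suc≮ n p = <-irrefl (toℕ-fromℕ n) (s<s⁻¹ p)

module _ (m' k' : ℕ) where

  α-x-next : (i : Fin m') → α m' k' (inj₁ (inject₁ i)) ≡ inj₁ (suc i)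
  α-x-next i with suc (toℕ (inject₁ i)) <? suc m'
  ... | yes p = cong inj₁ (fromℕ<-inject₁ i p)
  ... | no ¬p = contradiction (s<s (inject₁ℕ< i)) ¬p

  α-x-last : α m' k' (inj₁ (fromℕ m')) ≡ inj₁ zero
  α-x-last with suc (toℕ (fromℕ m')) <? suc m'
  ... | yes p = contradiction p (fromℕ-suc≮ m')
  ... | no _  = refl

  α-y-next : (j : Fin k') → α m' k' (inj₂ (inject₁ j)) ≡ inj₂ (suc j)
  α-y-next j with suc (toℕ (inject₁ j)) <? suc k'
  ... | yes p = cong inj₂ (fromℕ<-inject₁ j p)
  ... | no ¬p = contradiction (s<s (inject₁ℕ< j)) ¬p

  α-y-last : α m' k' (inj₂ (fromℕ k')) ≡ inj₁ zero
  α-y-last with suc (toℕ (fromℕ k')) <? suc k'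
  ... | yes p = contradiction p (fromℕ-suc≮ k')
  ... | no _  = refl

  α-reaches-x₁ : ∀ x → Reaches (α m' k') (inj₁ zero) x
  α-reaches-x₁ (inj₁ i) = chain-reaches (α m' k') inj₁ (inj₁ zero) α-x-last α-x-next i
  α-reaches-x₁ (inj₂ j) = chain-reaches (α m' k') inj₂ (inj₁ zero) α-y-last α-y-next j

lemma3p9 : (m' k' : ℕ) (β : Partial (X m' k')) →
    NotFull β →
    (∀ x → (full (α m' k') ⨾ β) x ≡ (β ⨾ full (α m' k')) x) →
    IsEmpty β
lemma3p9 m' k' β notFull commute =
  commuting-with-funnel-isEmpty (α m' k') β commute (inj₁ zero) (α-reaches-x₁ m' k') notFull
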